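{- Let $\mathcal{C}\subseteq\mathcal{T}$ be a subcategory and $\sim$ a congruence relation on $\mathcal{C}$, and assume Axiom 1 ($\mathcal{C}$ contains every morphism of $\mathcal{T}$ that is an injective induced graph map) and Axiom 4 (for every AN $G$, if a triad of $G$ has wedges at two ordered triples with different centers, then both wedges are closed). Then, for any AN $G$, if a triad of $G$ has two wedges with different centers, every ordered triple of distinct actors of that triad has an alcove at it.
   Context: An affiliation network (AN) is a finite simple undirected bipartite graph whose nodes are actors and events, each edge joining an actor to an event. A graph map sends nodes to nodes and edges to edges; it is injective if injective on nodes and induced if its image is an induced subgraph of the target. For a set $S$ of actors of $G$, the subgraph scheduled by $S$ is induced by $S$ together with all events attended by at least two actors of $S$; a triad of $G$ is the subgraph scheduled by three actors. $\mathcal{T}$: objects are triads (ANs with three actors, each event attended by at least two), morphisms $H\to K$ are graph maps sending actors of $H$ to distinct actors of $K$ and events to events. A congruence relation is a family of equivalence relations on hom-sets compatible with composition. Fixed: $W$ = path $v_0v_1v_2v_3v_4$ (actors $v_0,v_2,v_4$; events $v_1,v_3$), $X$ = 6-cycle $v_0v_1\cdots v_5v_0$ (actors $v_0,v_2,v_4$; events $v_1,v_3,v_5$), $\iota:W\to X$, $\iota(v_i)=v_i$. For an AN $G$, $\mathsf{Hom}_{\mathcal{C}/\sim}(H,G)$ is the set of $\sim$-classes of morphisms in $\mathcal{C}$ from $H$ into triads of $G$. Wedges are elements of $\mathsf{Hom}_{\mathcal{C}/\sim}(W,G)$; a wedge $\phi$ is closed if $\phi\sim\psi\circ\iota$ for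 some morphism $\psi$ in $\mathcal{C}$ from $X$ into a triad of $G$, open otherwise; alcoves are elements of $\mathsf{Hom}_{\mathcal{C}/\sim}(X,G)$. A wedge or alcove is at the ordered triple $(i,j,k)$ if it sends $v_0,v_2,v_4$ to $i,j,k$; its center is $j$. A triad has a wedge/alcove if it maps into that triad. -}

module Defs where

open import Data.Nat using (ℕ; zero; suc; _+_; _≤_; _≤?_)
open import Data.Fin using (Fin; zero; suc) renaming (_<_ to _<F_)
open import Data.Bool using (Bool; true; false; T)
open import Data.List using (List; []; _∷_; filter; length; lookup; allFin)
open import Data.List.Relation.Unary.All using (All; []; _∷_)
open import Data.List.Relation.Unary.All.Properties using (all-filter)
open import Data.Product using (Σ; ∃; _×_; _,_; proj₁; proj₂)
open import Relation.Binary.PropositionalEquality using (_≡_; _≢_; refl)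
open import Function.Definitions using (Injective)

-- Affiliation networks: finite simple bipartite graphs.
-- Actors are Fin nA, events are Fin nE, and adj a e = true iff the
-- edge {a , e} is present (edges only join an actor to an event).

record AN : Set where
  field
    nA  : ℕ
    nE  : ℕ
    adj : Fin nA → Fin nE → Bool

b2n : Bool → ℕ
b2n true  = 1
b2n false = 0

a0 a1 a2 : Fin 3
a0 = zero
a1 = suc zero
a2 = suc (suc zero)

record Triad : Set where
  field
    nE         : ℕ
    adj        : Fin 3 → Fin nE → Bool
    atLeastTwo : ∀ x → 2 ≤ b2n (adj a0 x) + b2n (adj a1 x) + b2n (adj a2 x)

open Triad

record Hom (H K : Triad) : Set where
  field
    act    : Fin 3 → Fin 3
    ev     : Fin (nE H) → Fin (nE K)
    actInj : Injective _≡_ _≡_ act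
    edge   : ∀ i x → T (adj H i x) → T (adj K (act i) (ev x))

open Hom public

idH : ∀ {H} → Hom H H
idH = record { act = λ i → i ; ev = λ x → x ; actInj = λ p → p ; edge = λ i x e → e }

_∘H_ : ∀ {H K L} → Hom K L → Hom H K → Hom H L
g ∘H f = record
  { act    = λ i → act g (act f i)
  ; ev     = λ x → ev g (ev f x)
  ; actInj = λ p → actInj f (actInj g p)
  ; edge   = λ i x e → edge g (act f i) (ev f x) (edge f i x e)
  }

_≗H_ : ∀ {H K} → Hom H K → Hom H K → Set
f ≗H g = (∀ i → act f i ≡ act g i) × (∀ x → ev f x ≡ ev g x)

-- An injective induced graph map: injective on all nodes, and its image is
-- an induced subgraph (every edge of K between image nodes is an image edge).
InjInduced : ∀ {H K} → Hom H K → Set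
InjInduced {H} {K} f =
  Injective _≡_ _≡_ (ev f) × (∀ i x → T (adj K (act f i) (ev f x)) → T (adj H i x))

record SubcatCong : Set₁ where
  field
    InC    : ∀ {H K} → Hom H K → Set
    InC-id : ∀ {H} → InC (idH {H})
    InC-∘  : ∀ {H K L} {g : Hom K L} {f : Hom H K} → InC g → InC f → InC (g ∘H f)
    InC-≗  : ∀ {H K} {f g : Hom H K} → f ≗H g → InC f → InC g
    _∼_    : ∀ {H K} → Hom H K → Hom H K → Set
    ∼-refl  : ∀ {H K} {f : Hom H K} → InC f → f ∼ f
    ∼-sym   : ∀ {H K} {f g : Hom H K} → InC f → InC g → f ∼ g → g ∼ f
    ∼-trans : ∀ {H K} {f g h : Hom H K} → InC f → InC g → InC h → f ∼ g → g ∼ h → f ∼ h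
    ∼-≗     : ∀ {H K} {f g : Hom H K} → InC f → f ≗H g → f ∼ g
    ∼-∘     : ∀ {H K L} {g g' : Hom K L} {f f' : Hom H K} →
              InC g → InC g' → InC f → InC f' → g ∼ g' → f ∼ f' → (g ∘H f) ∼ (g' ∘H f')

-- The fixed triads W (path v0 v1 v2 v3 v4) and X (6-cycle), and ι : W → X.
-- Actors v0, v2, v4 are a0, a1, a2; events v1, v3, v5 are e0, e1, e2.

adjW : Fin 3 → Fin 2 → Bool
adjW zero          zero       = true
adjW (suc zero)    zero       = true
adjW (suc zero)    (suc zero) = true
adjW (suc (suc zero)) (suc zero) = true
adjW _ _ = false

W : Triad
W = record { nE = 2 ; adj = adjW ; atLeastTwo = λ { zero → Data.Nat.s≤s (Data.Nat.s≤s Data.Nat.z≤n)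
                                                 ; (suc zero) → Data.Nat.s≤s (Data.Nat.s≤s Data.Nat.z≤n) } }

adjX : Fin 3 → Fin 3 → Bool
adjX zero          zero             = true
adjX (suc zero)    zero             = true
adjX (suc zero)    (suc zero)       = true
adjX (suc (suc zero)) (suc zero)    = true
adjX (suc (suc zero)) (suc (suc zero)) = true
adjX zero          (suc (suc zero)) = true
adjX _ _ = false

X : Triad
X = record { nE = 3 ; adj = adjX ; atLeastTwo = λ { zero → Data.Nat.s≤s (Data.Nat.s≤s Data.Nat.z≤n)
                                                 ; (suc zero) → Data.Nat.s≤s (Data.Nat.s≤s Data.Nat.z≤n)
                                                 ; (suc (suc zero)) → Data.Nat.s≤s (Data.Nat.s≤s Data.Nat.z≤n) } }

ι : Hom W X
ι = record
  { act    = λ i → i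
  ; ev     = λ { zero → zero ; (suc zero) → suc zero }
  ; actInj = λ p → p
  ; edge   = λ { zero zero e → e ; (suc zero) zero e → e ; (suc zero) (suc zero) e → e
               ; (suc (suc zero)) (suc zero) e → e } }

-- A 3-set S of actors of G is given canonically as a
-- strictly increasing map s : Fin 3 → actors of G.

ActorTriple : AN → Set
ActorTriple G = Σ (Fin 3 → Fin (AN.nA G)) λ s → (s a0 <F s a1) × (s a1 <F s a2)

allLookup : ∀ {A : Set} {P : A → Set} {xs : List A} → All P xs → ∀ i → P (lookup xs i)
allLookup (px ∷ _)  zero    = px
allLookup (_ ∷ pxs) (suc i) = allLookup pxs i

module Sched (G : AN) (s : Fin 3 → Fin (AN.nA G)) where
  att : Fin (AN.nE G) → ℕ
  att x = b2n (AN.adj G (s a0) x) + b2n (AN.adj G (s a1) x) + b2n (AN.adj G (s a2) x)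

  evs : List (Fin (AN.nE G))
  evs = filter (λ x → 2 ≤? att x) (allFin (AN.nE G))

  triad : Triad
  triad = record
    { nE         = length evs
    ; adj        = λ i x → AN.adj G (s i) (lookup evs x)
    ; atLeastTwo = allLookup (all-filter (λ x → 2 ≤? att x) (allFin (AN.nE G)))
    }

triadOf : (G : AN) → ActorTriple G → Triad
triadOf G S = Sched.triad G (proj₁ S)

module _ (𝒞 : SubcatCong) where
  open SubcatCong 𝒞

  Axiom1 : Set
  Axiom1 = ∀ {H K} (f : Hom H K) → InjInduced f → InC f

  Closed : ∀ {t} → Hom W t → Set
  Closed {t} φ = Σ (Hom X t) λ ψ → InC ψ × (φ ∼ (ψ ∘H ι))

  center : (G : AN) (S : ActorTriple G) → Hom W (triadOf G S) → Fin (AN.nA G)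
  center G S φ = proj₁ S (act φ a1)

  Axiom4 : Set
  Axiom4 = (G : AN) (S : ActorTriple G) (φ₁ φ₂ : Hom W (triadOf G S)) →
           InC φ₁ → InC φ₂ → center G S φ₁ ≢ center G S φ₂ →
           Closed φ₁ × Closed φ₂

  HasTwoCenters : (G : AN) → ActorTriple G → Set
  HasTwoCenters G S = Σ (Hom W (triadOf G S)) λ φ₁ → Σ (Hom W (triadOf G S)) λ φ₂ →
                      InC φ₁ × InC φ₂ × center G S φ₁ ≢ center G S φ₂

  AlcoveAt : (G : AN) (S : ActorTriple G) → Fin 3 → Fin 3 → Fin 3 → Set
  AlcoveAt G S p q r = Σ (Hom X (triadOf G S)) λ ψ →
                       InC ψ × act ψ a0 ≡ p × act ψ a1 ≡ q × act ψ a2 ≡ r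

-- Axiom 4 makes a wedge of the triad closed, so the triad receives a 𝒞-morphism
-- ψ from the 6-cycle X.  Every permutation of the actors of X extends to an
-- automorphism of X (each event of X is determined by the one actor it misses),
-- and these automorphisms are injective induced, hence in 𝒞 by Axiom 1.  Since ψ
-- is bijective on actors, precomposing it with a suitable automorphism places
-- an alcove at any ordered triple of distinct actors.
module Submission where

open import Defs
open import Data.Fin using (Fin; zero; suc; punchOut; _<_)
open import Data.Fin.Properties using (any?; pigeonhole; punchOut-injective; <⇒≢; _≟_)
import Data.Nat as ℕ
open import Data.Nat.Properties using (n<1+n)
open import Data.Bool using (T)
open import Data.Unit using (tt)
open import Data.Empty using (⊥-elim)
open import Data.Product using (∃₂; _×_; _,_; proj₁; proj₂)
open import Relation.Nullary using (¬_; yes; no)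
open import Relation.Binary.PropositionalEquality using (_≡_; _≢_; refl; sym; trans; cong; module ≡-Reasoning)
open import Function.Definitions using (Injective; Surjective)

injective⇒surjective : ∀ {n} {f : Fin n → Fin n} →
                       Injective _≡_ _≡_ f → Surjective _≡_ _≡_ f
injective⇒surjective {ℕ.zero}          _     ()
injective⇒surjective {ℕ.suc m} {f = f} f-inj y with any? (λ i → f i ≟ y)
... | yes (i , fi≡y) = i , λ { refl → fi≡y }
... | no ∄i = ⊥-elim (collision (pigeonhole (n<1+n m) g))
  where
  y≢f : ∀ i → y ≢ f i
  y≢f i y≡fi = ∄i (i , sym y≡fi)
  -- f misses y, so punching y out turns f into a map into Fin m that pigeonhole makes collide
  g : Fin (ℕ.suc m) → Fin m
  g i = punchOut (y≢f i)
  collision : ¬ ∃₂ λ i j → i < j × g i ≡ g j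
  collision (i , j , i<j , gi≡gj) = <⇒≢ i<j (f-inj (punchOut-injective (y≢f i) (y≢f j) gi≡gj))

triple : ∀ {A : Set} → A → A → A → Fin 3 → A
triple p q r zero             = p
triple p q r (suc zero)       = q
triple p q r (suc (suc zero)) = r

triple-injective : ∀ {A : Set} {p q r : A} → p ≢ q → q ≢ r → p ≢ r →
                   Injective _≡_ _≡_ (triple p q r)
triple-injective p≢q q≢r p≢r {zero}             {zero}             _ = refl
triple-injective p≢q q≢r p≢r {zero}             {suc zero}         e = ⊥-elim (p≢q e)
triple-injective p≢q q≢r p≢r {zero}             {suc (suc zero)}   e = ⊥-elim (p≢r e)
triple-injective p≢q q≢r p≢r {suc zero}         {zero}             e = ⊥-elim (p≢q (sym e))
triple-injective p≢q q≢r p≢r {suc zero}         {suc zero}         _ = refl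
triple-injective p≢q q≢r p≢r {suc zero}         {suc (suc zero)}   e = ⊥-elim (q≢r e)
triple-injective p≢q q≢r p≢r {suc (suc zero)}   {zero}             e = ⊥-elim (p≢r (sym e))
triple-injective p≢q q≢r p≢r {suc (suc zero)}   {suc zero}         e = ⊥-elim (q≢r (sym e))
triple-injective p≢q q≢r p≢r {suc (suc zero)}   {suc (suc zero)}   _ = refl

-- In the 6-cycle X every event is attended by exactly two of the three actors,
-- so an event is determined by the actor it misses.
missedActor : Fin 3 → Fin 3
missedActor zero             = a2
missedActor (suc zero)       = a0
missedActor (suc (suc zero)) = a1

eventMissing : Fin 3 → Fin 3
eventMissing zero             = suc zero
eventMissing (suc zero)       = suc (suc zero)
eventMissing (suc (suc zero)) = zero

missedActor-eventMissing : ∀ i → missedActor (eventMissing i) ≡ i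
missedActor-eventMissing zero             = refl
missedActor-eventMissing (suc zero)       = refl
missedActor-eventMissing (suc (suc zero)) = refl

eventMissing-missedActor : ∀ x → eventMissing (missedActor x) ≡ x
eventMissing-missedActor zero             = refl
eventMissing-missedActor (suc zero)       = refl
eventMissing-missedActor (suc (suc zero)) = refl

adjX-missedActor : ∀ x → ¬ T (adjX (missedActor x) x)
adjX-missedActor zero             ()
adjX-missedActor (suc zero)       ()
adjX-missedActor (suc (suc zero)) ()

adjX-≢missedActor : ∀ i x → i ≢ missedActor x → T (adjX i x)
adjX-≢missedActor zero             zero             _ = tt
adjX-≢missedActor zero             (suc zero)       i≢m = ⊥-elim (i≢m refl)
adjX-≢missedActor zero             (suc (suc zero)) _ = tt
adjX-≢missedActor (suc zero)       zero             _ = tt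
adjX-≢missedActor (suc zero)       (suc zero)       _ = tt
adjX-≢missedActor (suc zero)       (suc (suc zero)) i≢m = ⊥-elim (i≢m refl)
adjX-≢missedActor (suc (suc zero)) zero             i≢m = ⊥-elim (i≢m refl)
adjX-≢missedActor (suc (suc zero)) (suc zero)       _ = tt
adjX-≢missedActor (suc (suc zero)) (suc (suc zero)) _ = tt

adjX⇒≢missedActor : ∀ {i x} → T (adjX i x) → i ≢ missedActor x
adjX⇒≢missedActor {x = x} adj refl = adjX-missedActor x adj

module Relabel {π : Fin 3 → Fin 3} (π-injective : Injective _≡_ _≡_ π) where

  relabelEvent : Fin 3 → Fin 3
  relabelEvent x = eventMissing (π (missedActor x))

  missedActor-relabelEvent : ∀ x → missedActor (relabelEvent x) ≡ π (missedActor x)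
  missedActor-relabelEvent x = missedActor-eventMissing (π (missedActor x))

  relabelEvent-injective : Injective _≡_ _≡_ relabelEvent
  relabelEvent-injective {x} {y} e = begin
    x                                  ≡⟨ sym (eventMissing-missedActor x) ⟩
    eventMissing (missedActor x)       ≡⟨ cong eventMissing (π-injective π-missed-≡) ⟩
    eventMissing (missedActor y)       ≡⟨ eventMissing-missedActor y ⟩
    y                                  ∎
    where
    open ≡-Reasoning
    π-missed-≡ : π (missedActor x) ≡ π (missedActor y)
    π-missed-≡ = trans (sym (missedActor-relabelEvent x))
                       (trans (cong missedActor e) (missedActor-relabelEvent y))

  relabel : Hom X X
  relabel = record
    { act    = π
    ; ev     = relabelEvent
    ; actInj = π-injective
    ; edge   = λ i x adj → adjX-≢missedActor (π i) (relabelEvent x) λ πi≡m →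
                 adjX⇒≢missedActor adj (π-injective (trans πi≡m (missedActor-relabelEvent x)))
    }

  relabel-injInduced : InjInduced relabel
  relabel-injInduced = relabelEvent-injective , λ i x adj →
    adjX-≢missedActor i x λ i≡m →
      adjX⇒≢missedActor adj (trans (cong π i≡m) (sym (missedActor-relabelEvent x)))

open Relabel using (relabel; relabel-injInduced)

module _ (𝒞 : SubcatCong) where
  open SubcatCong 𝒞

  alcoveAt-everywhere : Axiom1 𝒞 → (G : AN) (S : ActorTriple G) →
                        (ψ : Hom X (triadOf G S)) → InC ψ →
                        (p q r : Fin 3) → p ≢ q → q ≢ r → p ≢ r → AlcoveAt 𝒞 G S p q r
  alcoveAt-everywhere axiom1 G S ψ ψ∈𝒞 p q r p≢q q≢r p≢r =
    ψ ∘H relabel π-injective ,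
    InC-∘ ψ∈𝒞 (axiom1 (relabel π-injective) (relabel-injInduced π-injective)) ,
    ψ∘π≡triple a0 , ψ∘π≡triple a1 , ψ∘π≡triple a2
    where
    ψ-surjective : Surjective _≡_ _≡_ (act ψ)
    ψ-surjective = injective⇒surjective (actInj ψ)

    π : Fin 3 → Fin 3
    π i = proj₁ (ψ-surjective (triple p q r i))

    ψ∘π≡triple : ∀ i → act ψ (π i) ≡ triple p q r i
    ψ∘π≡triple i = proj₂ (ψ-surjective (triple p q r i)) refl

    π-injective : Injective _≡_ _≡_ π
    π-injective {i} {j} πi≡πj = triple-injective p≢q q≢r p≢r
      (trans (sym (ψ∘π≡triple i)) (trans (cong (act ψ) πi≡πj) (ψ∘π≡triple j)))

lemma2 : (𝒞 : SubcatCong) → Axiom1 𝒞 → Axiom4 𝒞 →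
         (G : AN) (S : ActorTriple G) → HasTwoCenters 𝒞 G S →
         (p q r : Fin 3) → p ≢ q → q ≢ r → p ≢ r → AlcoveAt 𝒞 G S p q r
lemma2 𝒞 axiom1 axiom4 G S (φ₁ , φ₂ , φ₁∈𝒞 , φ₂∈𝒞 , centers≢)
  with ψ , ψ∈𝒞 , _ ← proj₁ (axiom4 G S φ₁ φ₂ φ₁∈𝒞 φ₂∈𝒞 centers≢) =
  alcoveAt-everywhere 𝒞 axiom1 G S ψ ψ∈𝒞
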